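{- For any connected graph $G$, $\gamma_{1/2}(G)\leq \lceil \gamma(G)/2\rceil$.
   Context: All graphs are finite and simple. For a graph $G=(V,E)$ and $v\in V$, $N[v]=\{v\}\cup\{u : uv\in E\}$, and for $S\subseteq V$, $N[S]=\bigcup_{u\in S}N[u]$. A set $S$ is dominating if $N[S]=V$, and $\gamma(G)$ is the minimum cardinality of a dominating set. For $p\in[0,1]$, a set $S\subseteq V$ is a $p$-dominating set if $|N[S]|/|V|\geq p$; $\gamma_p(G)$ is the minimum cardinality of a $p$-dominating set of $G$. -}

module Defs where

open import Data.Nat using (ℕ; suc; _+_; _*_; _≤_; _/_)
open import Data.Bool using (Bool; true; false; T)
open import Data.Fin using (Fin)
open import Data.Fin.Subset using (Subset; _∈_; ∣_∣)
open import Data.Vec using (tabulate)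
open import Data.Product using (Σ; ∃; ∃-syntax; _×_; _,_)
open import Data.List using (List; []; _∷_)
open import Relation.Binary.PropositionalEquality using (_≡_)
open import Relation.Nullary using (¬_)

record Graph (n : ℕ) : Set where
  field
    adj     : Fin n → Fin n → Bool
    sym     : ∀ u v → adj u v ≡ adj v u
    irrefl  : ∀ v → adj v v ≡ false
open Graph public

InClosedNbhd : ∀ {n} → Graph n → Fin n → Fin n → Set
InClosedNbhd G v u = (u ≡ v) Data.Sum.⊎ T (adj G u v)
  where import Data.Sum

InNS : ∀ {n} → Graph n → Subset n → Fin n → Set
InNS G S u = ∃[ v ] (v ∈ S × InClosedNbhd G v u)

data Walk {n : ℕ} (G : Graph n) : Fin n → Fin n → Set where
  here : ∀ {u} → Walk G u u
  step : ∀ {u w v} → T (adj G u w) → Walk G w v → Walk G u v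

Connected : ∀ {n} → Graph n → Set
Connected G = ∀ u v → Walk G u v

Dominating : ∀ {n} → Graph n → Subset n → Set
Dominating G S = ∀ u → InNS G S u

-- S is a 1/2-dominating set: |N[S]| / |V| ≥ 1/2, i.e. 2·|N[S]| ≥ |V|.
-- N[S] is given as an explicit subset T with  u ∈ T ⇔ u ∈ N[S].
IsClosedNbhdOf : ∀ {n} → Graph n → Subset n → Subset n → Set
IsClosedNbhdOf G S NS = ∀ u → (u ∈ NS → InNS G S u) × (InNS G S u → u ∈ NS)

HalfDominating : ∀ {n} → Graph n → Subset n → Set
HalfDominating {n} G S = ∃[ NS ] (IsClosedNbhdOf G S NS × n ≤ 2 * ∣ NS ∣)

IsDominationNumber : ∀ {n} → Graph n → ℕ → Set
IsDominationNumber G k =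
  (∃[ D ] (Dominating G D × ∣ D ∣ ≡ k)) × (∀ D → Dominating G D → k ≤ ∣ D ∣)

IsHalfDominationNumber : ∀ {n} → Graph n → ℕ → Set
IsHalfDominationNumber G k =
  (∃[ S ] (HalfDominating G S × ∣ S ∣ ≡ k)) × (∀ S → HalfDominating G S → k ≤ ∣ S ∣)

⌈_/2⌉ : ℕ → ℕ
⌈ m /2⌉ = suc m / 2

-- Split a minimum dominating set D into two parts of sizes ⌈|D|/2⌉ and
-- ⌊|D|/2⌋. Their closed neighbourhoods together cover V, so one of them
-- covers at least half of V and is a 1/2-dominating set of size at most
-- ⌈γ(G)/2⌉.
module Submission where

open import Defs hiding (sym)
open import Data.Bool using (Bool; true; false; not; T)
open import Data.Bool.Properties using (T-≡)
open import Data.Fin using (Fin; _≟_)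
open import Data.Fin.Properties using (any?)
open import Data.Fin.Subset using (Subset; _∈_; _∪_; ∣_∣; ⊤; inside; outside)
open import Data.Fin.Subset.Properties
  using (_∈?_; ∣⊤∣≡n; p⊆q⇒∣p∣≤∣q∣; x∈p∪q⁺)
open import Data.Nat using (ℕ; zero; suc; _+_; _*_; _/_; _≤_; z≤n; s≤s; ⌊_/2⌋)
  renaming (⌈_/2⌉ to ⌈_/2⌉ᴺ)
open import Data.Nat.DivMod using (m/n≡1+[m∸n]/n)
open import Data.Nat.Properties
  using (≤-trans; ≤-reflexive; ≤-total; n≤1+n; +-suc; +-monoʳ-≤; +-monoˡ-≤;
         +-identityʳ; ⌊n/2⌋≤⌈n/2⌉; module ≤-Reasoning)
open import Data.Product using (_×_; _,_; proj₁; proj₂)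
open import Data.Sum using (_⊎_; inj₁; inj₂; [_,_]′) renaming (map to ⊎-map)
open import Data.Vec using ([]; _∷_; tabulate; here; there)
open import Data.Vec.Properties using (lookup∘tabulate; []=⇒lookup; lookup⇒[]=)
open import Function using (_∘_)
open import Function.Bundles using (Equivalence)
open import Relation.Binary.PropositionalEquality using (_≡_; refl; sym; trans; cong)
open import Relation.Nullary using (Dec)
open import Relation.Nullary.Decidable using (isYes; _×-dec_; _⊎-dec_; T?; toWitness; fromWitness)

private
  variable
    n : ℕ

⌊n/2⌋≡n/2 : ∀ m → ⌊ m /2⌋ ≡ m / 2
⌊n/2⌋≡n/2 zero          = refl
⌊n/2⌋≡n/2 (suc zero)    = refl
⌊n/2⌋≡n/2 (suc (suc m)) =
  trans (cong suc (⌊n/2⌋≡n/2 m)) (sym (m/n≡1+[m∸n]/n {suc (suc m)} {2} (s≤s (s≤s z≤n))))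

⌈n/2⌉ᴺ≡⌈n/2⌉ : ∀ m → ⌈ m /2⌉ᴺ ≡ ⌈ m /2⌉
⌈n/2⌉ᴺ≡⌈n/2⌉ m = ⌊n/2⌋≡n/2 (suc m)

m≤a+b⇒m≤2a⊎m≤2b : ∀ {m} a b → m ≤ a + b → m ≤ 2 * a ⊎ m ≤ 2 * b
m≤a+b⇒m≤2a⊎m≤2b {m} a b m≤a+b with ≤-total a b
... | inj₁ a≤b = inj₂ (begin
  m           ≤⟨ m≤a+b ⟩
  a + b       ≤⟨ +-monoˡ-≤ b a≤b ⟩
  b + b       ≡⟨ cong (b +_) (sym (+-identityʳ b)) ⟩
  2 * b       ∎)
  where open ≤-Reasoning
... | inj₂ b≤a = inj₁ (begin
  m           ≤⟨ m≤a+b ⟩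
  a + b       ≤⟨ +-monoʳ-≤ a b≤a ⟩
  a + a       ≡⟨ cong (a +_) (sym (+-identityʳ a)) ⟩
  2 * a       ∎)
  where open ≤-Reasoning

∣p∪q∣≤∣p∣+∣q∣ : ∀ (p q : Subset n) → ∣ p ∪ q ∣ ≤ ∣ p ∣ + ∣ q ∣
∣p∪q∣≤∣p∣+∣q∣ []            []            = z≤n
∣p∪q∣≤∣p∣+∣q∣ (outside ∷ p) (outside ∷ q) = ∣p∪q∣≤∣p∣+∣q∣ p q
∣p∪q∣≤∣p∣+∣q∣ (outside ∷ p) (inside  ∷ q) =
  ≤-trans (s≤s (∣p∪q∣≤∣p∣+∣q∣ p q)) (≤-reflexive (sym (+-suc ∣ p ∣ ∣ q ∣)))
∣p∪q∣≤∣p∣+∣q∣ (inside  ∷ p) (outside ∷ q) = s≤s (∣p∪q∣≤∣p∣+∣q∣ p q)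
∣p∪q∣≤∣p∣+∣q∣ (inside  ∷ p) (inside  ∷ q) =
  s≤s (≤-trans (∣p∪q∣≤∣p∣+∣q∣ p q) (+-monoʳ-≤ ∣ p ∣ (n≤1+n ∣ q ∣)))

cover⇒n≤∣p∣+∣q∣ : ∀ (p q : Subset n) → (∀ x → x ∈ p ⊎ x ∈ q) → n ≤ ∣ p ∣ + ∣ q ∣
cover⇒n≤∣p∣+∣q∣ {n} p q cover = begin
  n            ≡⟨ sym (∣⊤∣≡n n) ⟩
  ∣ ⊤ {n} ∣    ≤⟨ p⊆q⇒∣p∣≤∣q∣ {p = ⊤} (λ {x} _ → x∈p∪q⁺ (cover x)) ⟩
  ∣ p ∪ q ∣    ≤⟨ ∣p∪q∣≤∣p∣+∣q∣ p q ⟩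
  ∣ p ∣ + ∣ q ∣ ∎
  where open ≤-Reasoning

x∈tabulate⁺ : ∀ (f : Fin n → Bool) {x} → T (f x) → x ∈ tabulate f
x∈tabulate⁺ f {x} fx =
  lookup⇒[]= x (tabulate f) (trans (lookup∘tabulate f x) (Equivalence.to T-≡ fx))

x∈tabulate⁻ : ∀ (f : Fin n → Bool) {x} → x ∈ tabulate f → T (f x)
x∈tabulate⁻ f {x} x∈f =
  Equivalence.from T-≡ (trans (sym (lookup∘tabulate f x)) ([]=⇒lookup x∈f))

everyOther : Bool → Subset n → Subset n
everyOther b []            = []
everyOther b (outside ∷ p) = outside ∷ everyOther b p
everyOther b (inside  ∷ p) = b ∷ everyOther (not b) p

x∈p⇒x∈everyOther : ∀ b (p : Subset n) {x} → x ∈ p →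
                   x ∈ everyOther b p ⊎ x ∈ everyOther (not b) p
x∈p⇒x∈everyOther true  (inside  ∷ p) here      = inj₁ here
x∈p⇒x∈everyOther false (inside  ∷ p) here      = inj₂ here
x∈p⇒x∈everyOther b     (outside ∷ p) (there m) =
  ⊎-map there there (x∈p⇒x∈everyOther b p m)
x∈p⇒x∈everyOther true  (inside  ∷ p) (there m) =
  ⊎-map there there (x∈p⇒x∈everyOther false p m)
x∈p⇒x∈everyOther false (inside  ∷ p) (there m) =
  ⊎-map there there (x∈p⇒x∈everyOther true p m)

∣everyOther∣ : ∀ (p : Subset n) →
  ∣ everyOther true p ∣ ≡ ⌈ ∣ p ∣ /2⌉ᴺ × ∣ everyOther false p ∣ ≡ ⌊ ∣ p ∣ /2⌋
∣everyOther∣ []            = refl , refl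
∣everyOther∣ (outside ∷ p) = ∣everyOther∣ p
∣everyOther∣ (inside  ∷ p) with ∣everyOther∣ p
... | ∣odd∣ , ∣even∣ = cong suc ∣even∣ , ∣odd∣

∣everyOther∣≤⌈∣p∣/2⌉ : ∀ b (p : Subset n) → ∣ everyOther b p ∣ ≤ ⌈ ∣ p ∣ /2⌉ᴺ
∣everyOther∣≤⌈∣p∣/2⌉ true  p = ≤-reflexive (proj₁ (∣everyOther∣ p))
∣everyOther∣≤⌈∣p∣/2⌉ false p =
  ≤-trans (≤-reflexive (proj₂ (∣everyOther∣ p))) (⌊n/2⌋≤⌈n/2⌉ ∣ p ∣)

InNS? : (G : Graph n) (S : Subset n) → ∀ u → Dec (InNS G S u)
InNS? G S u = any? (λ v → (v ∈? S) ×-dec ((u ≟ v) ⊎-dec T? (adj G u v)))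

closedNbhd : Graph n → Subset n → Subset n
closedNbhd G S = tabulate (isYes ∘ InNS? G S)

closedNbhd-isClosedNbhdOf : (G : Graph n) (S : Subset n) →
                            IsClosedNbhdOf G S (closedNbhd G S)
closedNbhd-isClosedNbhdOf G S u =
    (λ u∈N → toWitness {a? = InNS? G S u} (x∈tabulate⁻ (isYes ∘ InNS? G S) u∈N))
  , (λ u∈NS → x∈tabulate⁺ (isYes ∘ InNS? G S) (fromWitness {a? = InNS? G S u} u∈NS))

halfDominating-of-cover : (G : Graph n) (S T : Subset n) →
  (∀ u → InNS G S u ⊎ InNS G T u) → HalfDominating G S ⊎ HalfDominating G T
halfDominating-of-cover G S T cover =
  ⊎-map (λ le → closedNbhd G S , closedNbhd-isClosedNbhdOf G S , le)
        (λ le → closedNbhd G T , closedNbhd-isClosedNbhdOf G T , le)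
        (m≤a+b⇒m≤2a⊎m≤2b ∣ closedNbhd G S ∣ ∣ closedNbhd G T ∣
          (cover⇒n≤∣p∣+∣q∣ _ _ inN))
  where
  inN : ∀ u → u ∈ closedNbhd G S ⊎ u ∈ closedNbhd G T
  inN u = ⊎-map (proj₂ (closedNbhd-isClosedNbhdOf G S u))
                (proj₂ (closedNbhd-isClosedNbhdOf G T u)) (cover u)

dominating⇒halfDominating-everyOther : (G : Graph n) (D : Subset n) → Dominating G D →
  HalfDominating G (everyOther true D) ⊎ HalfDominating G (everyOther false D)
dominating⇒halfDominating-everyOther G D dom =
  halfDominating-of-cover G _ _ λ u → split (dom u)
  where
  split : ∀ {u} → InNS G D u →
          InNS G (everyOther true D) u ⊎ InNS G (everyOther false D) u
  split (v , v∈D , vu) =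
    ⊎-map (λ m → v , m , vu) (λ m → v , m , vu) (x∈p⇒x∈everyOther true D v∈D)

theorem3p3 : ∀ {n} (G : Graph n) → Connected G →
    ∀ g h → IsDominationNumber G g → IsHalfDominationNumber G h → h ≤ ⌈ g /2⌉
theorem3p3 G _ g h ((D , dom , ∣D∣≡g) , _) (_ , h-min) =
  [ bound true , bound false ]′ (dominating⇒halfDominating-everyOther G D dom)
  where
  bound : ∀ b → HalfDominating G (everyOther b D) → h ≤ ⌈ g /2⌉
  bound b half = begin
    h                         ≤⟨ h-min (everyOther b D) half ⟩
    ∣ everyOther b D ∣        ≤⟨ ∣everyOther∣≤⌈∣p∣/2⌉ b D ⟩
    ⌈ ∣ D ∣ /2⌉ᴺ              ≡⟨ ⌈n/2⌉ᴺ≡⌈n/2⌉ ∣ D ∣ ⟩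
    ⌈ ∣ D ∣ /2⌉               ≡⟨ cong ⌈_/2⌉ ∣D∣≡g ⟩
    ⌈ g /2⌉                   ∎
    where open ≤-Reasoning
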